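{- Let $n$ be an odd integer and let $(p_i)_{i\in\mathbb{Z}}$ be an $n$-periodic sequence of points of $\mathbb{CP}^1$ with $p_i\ne p_{i+1}$ for all $i$, representing an element $p$ of $\widehat{\mathcal{M}}_{0,n}$. Let $(V_i)_{i\in\mathbb{Z}}$ be a lift of $(p_i)$ to $\mathbb{C}^2$ with $V_{i+n}=-V_i$ and $\det(V_{i+1},V_i)=1$ for all $i$, and let $(a_i)_{i\in\mathbb{Z}}$ be the ($n$-periodic) coefficients determined by $V_i=a_iV_{i-1}-V_{i-2}$ for all $i$. Let $f(p)=(e_{i,j})$ be the Coxeter frieze of width $n-3$ whose first row is given by $e_{i,i}=a_i$. Then, for all $i$, the entries of the second row of $f(p)$ are $$e_{i-1,i}=[p_{i-3},p_{i-2},p_{i-1},p_i]=\frac{(p_i-p_{i-3})(p_{i-1}-p_{i-2})}{(p_i-p_{i-1})(p_{i-2}-p_{i-3})}.$$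
   Context: $\widehat{\mathcal{M}}_{0,n}=\{(p_i)_{i\in\mathbb{Z}},\ p_i\in\mathbb{P}^1,\ p_{i+n}=p_i,\ p_i\ne p_{i+1}\}/\mathrm{PGL}_2$. Points of $\mathbb{CP}^1$ are written in an affine coordinate, and the cross ratio $[q_1,q_2,q_3,q_4]=\frac{(q_4-q_1)(q_3-q_2)}{(q_4-q_3)(q_2-q_1)}$ is extended by continuity when a point is $\infty$; it is $\mathrm{PGL}_2$-invariant. $\det(V,W)$ is the determinant of the matrix with columns $V,W$. Such a lift $(V_i)$ exists (unique up to sign) since $n$ is odd, and the $a_i$ exist since $V_{i-1},V_{i-2}$ form a basis. A Coxeter frieze of width $m$ is an array indexed by $(i,j)$ with $i\le j\le i+m-1$, displayed in rows: row $0$ consists of $1$'s, row $r$ ($1\le r\le m$) consists of the entries $e_{i,i+r-1}$, row $m+1$ consists of $1$'s (with conventions $e_{i,i-1}=e_{i,i+m}=1$, $e_{i,i-2}=e_{i,i+m+1}=0$), and any four entries forming a diamond $b$ (top), $a$ (left), $d$ (right), $c$ (bottom), namely $a=e_{i,j}$, $d=e_{i+1,j+1}$, $b=e_{i+1,j}$, $c=e_{i,j+1}$, satisfy $ad-bc=1$. In particular $e_{i,i+1}=a_ia_{i+1}-1$. -}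

module Defs where

open import Level using (Level; _⊔_) renaming (suc to lsuc)
open import Algebra.Bundles using (CommutativeRing)
open import Data.Product using (_×_; _,_; proj₁; proj₂)
open import Data.Maybe using (Maybe; just; nothing)
open import Data.Integer using (ℤ; +_) renaming (_+_ to _+ℤ_; _-_ to _-ℤ_; _≤_ to _≤ℤ_)
open import Relation.Nullary using (¬_)
open import Data.Empty using (⊥)
open import Data.Unit using (⊤)

-- A field: a commutative ring with 0 ≠ 1 and a (total) inverse map that is a
-- multiplicative inverse on nonzero elements (the value at 0 is irrelevant).
record Field (c ℓ : Level) : Set (lsuc (c ⊔ ℓ)) where
  field
    commutativeRing : CommutativeRing c ℓ
  open CommutativeRing commutativeRing public
  field
    _⁻¹      : Carrier → Carrier
    ⁻¹-cong  : ∀ {x y} → x ≈ y → x ⁻¹ ≈ y ⁻¹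
    inverse  : ∀ x → ¬ (x ≈ 0#) → (x * (x ⁻¹)) ≈ 1#
    0≉1      : ¬ (0# ≈ 1#)

module FieldDefs {c ℓ : Level} (F : Field c ℓ) where
  open Field F public

  K² : Set c
  K² = Carrier × Carrier

  _≈²_ : K² → K² → Set ℓ
  (x₁ , x₂) ≈² (y₁ , y₂) = (x₁ ≈ y₁) × (x₂ ≈ y₂)

  -²_ : K² → K²
  -² (x₁ , x₂) = (- x₁ , - x₂)

  _•_ : Carrier → K² → K²
  λ' • (x₁ , x₂) = (λ' * x₁ , λ' * x₂)

  _-²_ : K² → K² → K²
  (x₁ , x₂) -² (y₁ , y₂) = (x₁ - y₁ , x₂ - y₂)

  det : K² → K² → Carrier
  det (v₁ , v₂) (w₁ , w₂) = (v₁ * w₂) - (w₁ * v₂)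

  -- the projective line, in an affine coordinate: just x is the point x, nothing is ∞
  P¹ : Set c
  P¹ = Maybe Carrier

  _≈P_ : P¹ → P¹ → Set ℓ
  just x ≈P just y = x ≈ y
  nothing ≈P nothing = Level.Lift ℓ ⊤
  just _ ≈P nothing = Level.Lift ℓ ⊥
  nothing ≈P just _ = Level.Lift ℓ ⊥

  hom : P¹ → K²
  hom (just x) = (x , 1#)
  hom nothing = (1# , 0#)

  -- cross ratio [q1,q2,q3,q4] = (q4-q1)(q3-q2) / ((q4-q3)(q2-q1)), written with
  -- homogeneous coordinates (det(hom x, hom y) = x - y for finite points),
  -- which is exactly its extension by continuity when some point is ∞.
  crossRatio : P¹ → P¹ → P¹ → P¹ → Carrier
  crossRatio q₁ q₂ q₃ q₄ =
    (det (hom q₄) (hom q₁) * det (hom q₃) (hom q₂))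
      * ((det (hom q₄) (hom q₃) * det (hom q₂) (hom q₁)) ⁻¹)

  -- A Coxeter frieze of width m, given as an array e : ℤ → ℤ → K, where only the
  -- entries e i j with i - 2 ≤ j ≤ i + m + 1 are meaningful (conventions included).
  record IsCoxeterFrieze (m : ℤ) (e : ℤ → ℤ → Carrier) : Set ℓ where
    field
      row0     : ∀ i → e i (i -ℤ + 1) ≈ 1#
      rowLast  : ∀ i → e i (i +ℤ m) ≈ 1#
      conv0    : ∀ i → e i (i -ℤ + 2) ≈ 0#
      convLast : ∀ i → e i (i +ℤ m +ℤ + 1) ≈ 0#
      -- diamond rule: a = e i j, d = e (i+1) (j+1), b = e (i+1) j, c = e i (j+1),
      -- for a, d in row r = j - i + 1 with 1 ≤ r ≤ m
      diamond  : ∀ i j → i ≤ℤ j → j ≤ℤ i +ℤ m -ℤ + 1 →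
                 ((e i j * e (i +ℤ + 1) (j +ℤ + 1)) - (e (i +ℤ + 1) j * e i (j +ℤ + 1))) ≈ 1#

-- The cross ratio is unchanged when the vectors hom pₖ are rescaled, so it can
-- be computed on the lift V.  There its denominator det(Vᵢ,Vᵢ₋₁) det(Vᵢ₋₂,Vᵢ₋₃)
-- is 1, so it equals det(Vᵢ,Vᵢ₋₃) det(Vᵢ₋₁,Vᵢ₋₂) = det(Vᵢ,Vᵢ₋₃).  Expanding Vᵢ and
-- then Vᵢ₋₁ by the recurrence gives det(Vᵢ,Vᵢ₋₃) = aᵢ₋₁ aᵢ - 1, which is also what
-- the diamond rule forces on eᵢ₋₁,ᵢ.  For n = 3 the frieze has width 0 and both
-- sides vanish, the cross ratio because pᵢ = pᵢ₋₃; n = 1 contradicts pᵢ ≠ pᵢ₊₁.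
module Submission where

open import Defs
open import Level using (Level)
open import Data.Nat using (ℕ; _∸_)
import Data.Nat as N
open import Data.Integer using (ℤ; +_) renaming (_+_ to _+ℤ_; _-_ to _-ℤ_)
open import Data.Product using (_×_; ∃)
open import Relation.Binary.PropositionalEquality using (_≡_)
open import Relation.Nullary using (¬_)

open import Algebra.Bundles using (Ring)
open import Data.Empty using (⊥-elim)
open import Data.Integer using (-1ℤ) renaming (_≤_ to _≤ℤ_)
import Data.Integer.Properties as ℤ
open import Data.Integer.Tactic.RingSolver using (solve-∀)
open import Data.Maybe using (just; nothing)
import Data.Nat.Properties as ℕ
open import Data.Product using (_,_)
import Relation.Binary.PropositionalEquality as ≡

private
  i-1+1≡i : ∀ i → (i -ℤ + 1) +ℤ + 1 ≡ i
  i-1+1≡i = solve-∀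

  i-1+0+1≡i : ∀ i → (i -ℤ + 1) +ℤ + 0 +ℤ + 1 ≡ i
  i-1+0+1≡i = solve-∀

  i-2+1≡i-1 : ∀ i → (i -ℤ + 2) +ℤ + 1 ≡ i -ℤ + 1
  i-2+1≡i-1 = solve-∀

  i-3+1≡i-2 : ∀ i → (i -ℤ + 3) +ℤ + 1 ≡ i -ℤ + 2
  i-3+1≡i-2 = solve-∀

  i-3+3≡i : ∀ i → (i -ℤ + 3) +ℤ + 3 ≡ i
  i-3+3≡i = solve-∀

  i-1-1≡i-2 : ∀ i → (i -ℤ + 1) -ℤ + 1 ≡ i -ℤ + 2
  i-1-1≡i-2 = solve-∀

  i-1-2≡i-3 : ∀ i → (i -ℤ + 1) -ℤ + 2 ≡ i -ℤ + 3
  i-1-2≡i-3 = solve-∀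

  i≤i+m-1 : ∀ i {m} → 1 N.≤ m → i ≤ℤ i +ℤ + m -ℤ + 1
  i≤i+m-1 i {N.suc m} _ =
    ≡.subst (i ≤ℤ_) (≡.sym (ℤ.+-assoc i (+ N.suc m) -1ℤ)) (ℤ.i≤i+j i (+ m))

module RingProperties {a ℓ} (R : Ring a ℓ) where
  open Ring R
  open import Algebra.Properties.Ring R using (-‿+-comm; -‿involutive; -0#≈0#)
  open import Relation.Binary.Reasoning.Setoid setoid

  x-0≈x : ∀ x → x - 0# ≈ x
  x-0≈x x = trans (+-congˡ -0#≈0#) (+-identityʳ x)

  x-[x-y]≈y : ∀ x y → x - (x - y) ≈ y
  x-[x-y]≈y x y = begin
    x + - (x + - y)   ≈⟨ +-congˡ (-‿+-comm x (- y)) ⟨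
    x + (- x + - - y) ≈⟨ +-congˡ (+-congˡ (-‿involutive y)) ⟩
    x + (- x + y)     ≈⟨ +-assoc x (- x) y ⟨
    (x + - x) + y     ≈⟨ +-congʳ (-‿inverseʳ x) ⟩
    0# + y            ≈⟨ +-identityˡ y ⟩
    y                 ∎

  x-y≈1⇒y≈x-1 : ∀ {x y} → x - y ≈ 1# → y ≈ x - 1#
  x-y≈1⇒y≈x-1 {x} {y} x-y≈1 = begin
    y           ≈⟨ x-[x-y]≈y x y ⟨
    x - (x - y) ≈⟨ +-congˡ (-‿cong x-y≈1) ⟩
    x - 1#      ∎

module FieldProperties {c ℓ : Level} (F : Field c ℓ) where
  open FieldDefs F
  open RingProperties ring using (x-0≈x; x-y≈1⇒y≈x-1)
  open import Algebra.Properties.Ring ring using (x[y-z]≈xy-xz; [y-z]x≈yx-zx; -‿+-comm)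
  open import Algebra.Properties.CommutativeSemigroup *-commutativeSemigroup
    using (interchange; x∙yz≈y∙xz)
  open import Relation.Binary.Reasoning.Setoid setoid

  ⁻¹-unique : ∀ {x y} → x * y ≈ 1# → x ⁻¹ ≈ y
  ⁻¹-unique {x} {y} xy≈1 = begin
    x ⁻¹             ≈⟨ *-identityˡ (x ⁻¹) ⟨
    1# * x ⁻¹        ≈⟨ *-congʳ (trans (*-comm y x) xy≈1) ⟨
    (y * x) * x ⁻¹   ≈⟨ *-assoc y x (x ⁻¹) ⟩
    y * (x * x ⁻¹)   ≈⟨ *-congˡ (inverse x x≉0) ⟩
    y * 1#           ≈⟨ *-identityʳ y ⟩
    y                ∎
    where
    x≉0 : ¬ (x ≈ 0#)
    x≉0 x≈0 = 0≉1 (trans (sym (trans (*-congʳ x≈0) (zeroˡ y))) xy≈1)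

  ≈P-sym : ∀ x y → x ≈P y → y ≈P x
  ≈P-sym (just _) (just _) x≈y = sym x≈y
  ≈P-sym nothing  nothing  x≈y = x≈y

  det-cong : ∀ {v v′ w w′} → v ≈² v′ → w ≈² w′ → det v w ≈ det v′ w′
  det-cong (v₁≈ , v₂≈) (w₁≈ , w₂≈) = +-cong (*-cong v₁≈ w₂≈) (-‿cong (*-cong w₁≈ v₂≈))

  det-self : ∀ v → det v v ≈ 0#
  det-self (v₁ , v₂) = -‿inverseʳ (v₁ * v₂)

  det-hom-≈P : ∀ x y → x ≈P y → det (hom x) (hom y) ≈ 0#
  det-hom-≈P (just x) (just y) x≈y = trans (+-congˡ (-‿cong (*-congʳ (sym x≈y)))) (-‿inverseʳ _)
  det-hom-≈P nothing  nothing  _   = -‿inverseʳ _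

  det-subˡ : ∀ v w u → det (v -² w) u ≈ det v u - det w u
  det-subˡ (v₁ , v₂) (w₁ , w₂) (u₁ , u₂) = begin
    (v₁ - w₁) * u₂ - u₁ * (v₂ - w₂)
      ≈⟨ +-cong ([y-z]x≈yx-zx u₂ v₁ w₁) (-‿cong (x[y-z]≈xy-xz u₁ v₂ w₂)) ⟩
    (v₁ * u₂ - w₁ * u₂) - (u₁ * v₂ - u₁ * w₂)
      ≈⟨ +-congˡ (-‿+-comm (u₁ * v₂) (- (u₁ * w₂))) ⟨
    (v₁ * u₂ + - (w₁ * u₂)) + (- (u₁ * v₂) + - - (u₁ * w₂))
      ≈⟨ interchange′ _ _ _ _ ⟩
    (v₁ * u₂ - u₁ * v₂) + (- (w₁ * u₂) + - - (u₁ * w₂))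
      ≈⟨ +-congˡ (-‿+-comm (w₁ * u₂) (- (u₁ * w₂))) ⟩
    (v₁ * u₂ - u₁ * v₂) - (w₁ * u₂ - u₁ * w₂) ∎
    where
    open import Algebra.Properties.CommutativeSemigroup +-commutativeSemigroup
      using () renaming (interchange to interchange′)

  det-scaleˡ : ∀ l v u → det (l • v) u ≈ l * det v u
  det-scaleˡ l (v₁ , v₂) (u₁ , u₂) = begin
    (l * v₁) * u₂ - u₁ * (l * v₂) ≈⟨ +-cong (*-assoc l v₁ u₂) (-‿cong (x∙yz≈y∙xz u₁ l v₂)) ⟩
    l * (v₁ * u₂) - l * (u₁ * v₂) ≈⟨ x[y-z]≈xy-xz l _ _ ⟨
    l * (v₁ * u₂ - u₁ * v₂)       ∎

  det-scaleʳ : ∀ l v u → det v (l • u) ≈ l * det v u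
  det-scaleʳ l (v₁ , v₂) (u₁ , u₂) = begin
    v₁ * (l * u₂) - (l * u₁) * v₂ ≈⟨ +-cong (x∙yz≈y∙xz v₁ l u₂) (-‿cong (*-assoc l u₁ v₂)) ⟩
    l * (v₁ * u₂) - l * (u₁ * v₂) ≈⟨ x[y-z]≈xy-xz l _ _ ⟨
    l * (v₁ * u₂ - u₁ * v₂)       ∎

  det-lift : ∀ {V W l m h g} → V ≈² (l • h) → W ≈² (m • g) → det V W ≈ (l * m) * det h g
  det-lift {V} {W} {l} {m} {h} {g} V≈ W≈ = begin
    det V W             ≈⟨ det-cong V≈ W≈ ⟩
    det (l • h) (m • g) ≈⟨ det-scaleˡ l h (m • g) ⟩
    l * det h (m • g)   ≈⟨ *-congˡ (det-scaleʳ m h g) ⟩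
    l * (m * det h g)   ≈⟨ *-assoc l m _ ⟨
    (l * m) * det h g   ∎

  det-recurrenceˡ : ∀ {W U X a} Y → W ≈² ((a • U) -² X) → det W Y ≈ a * det U Y - det X Y
  det-recurrenceˡ {W} {U} {X} {a} Y W≈ = begin
    det W Y                  ≈⟨ det-cong W≈ (refl , refl) ⟩
    det ((a • U) -² X) Y     ≈⟨ det-subˡ (a • U) X Y ⟩
    det (a • U) Y - det X Y  ≈⟨ +-congʳ (det-scaleˡ a U Y) ⟩
    a * det U Y - det X Y    ∎

  det-skip-one : ∀ {W U X a} → W ≈² ((a • U) -² X) → det U X ≈ 1# → det W X ≈ a
  det-skip-one {W} {U} {X} {a} W≈ UX≈1 = begin
    det W X                ≈⟨ det-recurrenceˡ X W≈ ⟩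
    a * det U X - det X X  ≈⟨ +-cong (*-congˡ UX≈1) (-‿cong (det-self X)) ⟩
    a * 1# - 0#            ≈⟨ x-0≈x (a * 1#) ⟩
    a * 1#                 ≈⟨ *-identityʳ a ⟩
    a                      ∎

  det-skip-two : ∀ {V₀ V₁ V₂ V₃ a₂ a₃} →
    V₂ ≈² ((a₂ • V₁) -² V₀) → V₃ ≈² ((a₃ • V₂) -² V₁) → det V₁ V₀ ≈ 1# →
    det V₃ V₀ ≈ a₂ * a₃ - 1#
  det-skip-two {V₀} {V₁} {V₂} {V₃} {a₂} {a₃} V₂≈ V₃≈ V₁V₀≈1 = begin
    det V₃ V₀                   ≈⟨ det-recurrenceˡ V₀ V₃≈ ⟩
    a₃ * det V₂ V₀ - det V₁ V₀  ≈⟨ +-cong (*-congˡ (det-skip-one V₂≈ V₁V₀≈1)) (-‿cong V₁V₀≈1) ⟩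
    a₃ * a₂ - 1#                ≈⟨ +-congʳ (*-comm a₃ a₂) ⟩
    a₂ * a₃ - 1#                ∎

  crossRatio-coincident : ∀ q₀ q₁ q₂ q₃ → q₃ ≈P q₀ → crossRatio q₀ q₁ q₂ q₃ ≈ 0#
  crossRatio-coincident q₀ q₁ q₂ q₃ q₃≈q₀ =
    trans (*-congʳ (trans (*-congʳ (det-hom-≈P q₃ q₀ q₃≈q₀)) (zeroˡ _))) (zeroˡ _)

  crossRatio-lift : ∀ q₀ q₁ q₂ q₃ {V₀ V₁ V₂ V₃ l₀ l₁ l₂ l₃} →
    V₀ ≈² (l₀ • hom q₀) → V₁ ≈² (l₁ • hom q₁) → V₂ ≈² (l₂ • hom q₂) → V₃ ≈² (l₃ • hom q₃) →
    det V₃ V₂ ≈ 1# → det V₁ V₀ ≈ 1# →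
    crossRatio q₀ q₁ q₂ q₃ ≈ det V₃ V₀ * det V₂ V₁
  crossRatio-lift q₀ q₁ q₂ q₃ {V₀} {V₁} {V₂} {V₃} {l₀} {l₁} {l₂} {l₃}
                  V₀≈ V₁≈ V₂≈ V₃≈ V₃V₂≈1 V₁V₀≈1 = begin
    N * D ⁻¹
      ≈⟨ *-congˡ (⁻¹-unique DΛ≈1) ⟩
    N * Λ
      ≈⟨ *-comm N Λ ⟩
    Λ * N
      ≈⟨ *-congʳ Λ≈ ⟨
    ((l₃ * l₀) * (l₂ * l₁)) * N
      ≈⟨ interchange (l₃ * l₀) (H q₃ q₀) (l₂ * l₁) (H q₂ q₁) ⟨
    ((l₃ * l₀) * H q₃ q₀) * ((l₂ * l₁) * H q₂ q₁)
      ≈⟨ *-cong (det-lift V₃≈ V₀≈) (det-lift V₂≈ V₁≈) ⟨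
    det V₃ V₀ * det V₂ V₁ ∎
    where
    H : P¹ → P¹ → Carrier
    H x y = det (hom x) (hom y)
    N D Λ : Carrier
    N = H q₃ q₀ * H q₂ q₁
    D = H q₃ q₂ * H q₁ q₀
    Λ = (l₃ * l₂) * (l₁ * l₀)
    Λ≈ : (l₃ * l₀) * (l₂ * l₁) ≈ Λ
    Λ≈ = trans (interchange l₃ l₀ l₂ l₁) (*-congˡ (*-comm l₀ l₁))
    DΛ≈1 : D * Λ ≈ 1#
    DΛ≈1 = begin
      D * Λ
        ≈⟨ *-comm D Λ ⟩
      Λ * D
        ≈⟨ interchange (l₃ * l₂) (H q₃ q₂) (l₁ * l₀) (H q₁ q₀) ⟨
      ((l₃ * l₂) * H q₃ q₂) * ((l₁ * l₀) * H q₁ q₀)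
        ≈⟨ *-cong (det-lift V₃≈ V₂≈) (det-lift V₁≈ V₀≈) ⟨
      det V₃ V₂ * det V₁ V₀
        ≈⟨ *-cong V₃V₂≈1 V₁V₀≈1 ⟩
      1# * 1#
        ≈⟨ *-identityˡ 1# ⟩
      1# ∎

  det-consecutive : ∀ {V : ℤ → K²} → (∀ i → det (V (i +ℤ + 1)) (V i) ≈ 1#) →
    ∀ {j k} → j +ℤ + 1 ≡ k → det (V k) (V j) ≈ 1#
  det-consecutive unimodular ≡.refl = unimodular _

  det-three-apart : ∀ {V : ℤ → K²} {a : ℤ → Carrier} →
    (∀ i → V i ≈² ((a i • V (i -ℤ + 1)) -² V (i -ℤ + 2))) →
    (∀ i → det (V (i +ℤ + 1)) (V i) ≈ 1#) →
    ∀ i → det (V i) (V (i -ℤ + 3)) ≈ a (i -ℤ + 1) * a i - 1#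
  det-three-apart {V} {a} recurrence unimodular i =
    det-skip-two recurrence-at-i-1 (recurrence i) (det-consecutive unimodular (i-3+1≡i-2 i))
    where
    recurrence-at-i-1 : V (i -ℤ + 1) ≈² ((a (i -ℤ + 1) • V (i -ℤ + 2)) -² V (i -ℤ + 3))
    recurrence-at-i-1 = ≡.subst₂ (λ s t → V (i -ℤ + 1) ≈² ((a (i -ℤ + 1) • V s) -² V t))
      (i-1-1≡i-2 i) (i-1-2≡i-3 i) (recurrence (i -ℤ + 1))

  crossRatio-consecutive : ∀ {p : ℤ → P¹} {V : ℤ → K²} {lam : ℤ → Carrier} →
    (∀ i → V i ≈² (lam i • hom (p i))) →
    (∀ i → det (V (i +ℤ + 1)) (V i) ≈ 1#) →
    ∀ i → crossRatio (p (i -ℤ + 3)) (p (i -ℤ + 2)) (p (i -ℤ + 1)) (p i) ≈ det (V i) (V (i -ℤ + 3))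
  crossRatio-consecutive {p} {V} lift unimodular i = begin
    crossRatio (p (i -ℤ + 3)) (p (i -ℤ + 2)) (p (i -ℤ + 1)) (p i)
      ≈⟨ crossRatio-lift (p (i -ℤ + 3)) (p (i -ℤ + 2)) (p (i -ℤ + 1)) (p i)
           (lift _) (lift _) (lift _) (lift _)
           (det-consecutive unimodular (i-1+1≡i i)) (det-consecutive unimodular (i-3+1≡i-2 i)) ⟩
    det (V i) (V (i -ℤ + 3)) * det (V (i -ℤ + 1)) (V (i -ℤ + 2))
      ≈⟨ *-congˡ (det-consecutive unimodular (i-2+1≡i-1 i)) ⟩
    det (V i) (V (i -ℤ + 3)) * 1#
      ≈⟨ *-identityʳ _ ⟩
    det (V i) (V (i -ℤ + 3)) ∎

  frieze-secondRow : ∀ {m e} → 1 N.≤ m → IsCoxeterFrieze (+ m) e →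
    ∀ i → e (i -ℤ + 1) i ≈ e (i -ℤ + 1) (i -ℤ + 1) * e i i - 1#
  frieze-secondRow {m} {e} 1≤m frieze i = x-y≈1⇒y≈x-1 (begin
    e j j * e i i - e j i        ≈⟨ +-congˡ (-‿cong (trans (*-congʳ (row0 i)) (*-identityˡ _))) ⟨
    e j j * e i i - e i j * e j i ≈⟨ diamond-at-j ⟩
    1#                            ∎)
    where
    open IsCoxeterFrieze frieze
    j = i -ℤ + 1
    diamond-at-j : e j j * e i i - e i j * e j i ≈ 1#
    diamond-at-j = ≡.subst (λ t → e j j * e t t - e t j * e j t ≈ 1#) (i-1+1≡i i)
      (diamond j j ℤ.≤-refl (i≤i+m-1 j 1≤m))

  frieze-width0 : ∀ {e} → IsCoxeterFrieze (+ 0) e → ∀ i → e (i -ℤ + 1) i ≈ 0#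
  frieze-width0 {e} frieze i =
    ≡.subst (λ t → e (i -ℤ + 1) t ≈ 0#) (i-1+0+1≡i i) (IsCoxeterFrieze.convLast frieze (i -ℤ + 1))

proposition1p19 : ∀ {c ℓ : Level} (F : Field c ℓ) → let open FieldDefs F in
    (n : ℕ) → ∃ (λ k → n ≡ N.suc (2 N.* k)) →
    (p : ℤ → P¹) → (∀ i → p (i +ℤ + n) ≈P p i) → (∀ i → ¬ (p i ≈P p (i +ℤ + 1))) →
    (V : ℤ → K²) → (lam : ℤ → Carrier) → (∀ i → ¬ (lam i ≈ 0#)) →
    (∀ i → V i ≈² (lam i • hom (p i))) →
    (∀ i → V (i +ℤ + n) ≈² (-² V i)) → (∀ i → det (V (i +ℤ + 1)) (V i) ≈ 1#) →
    (a : ℤ → Carrier) → (∀ i → V i ≈² ((a i • V (i -ℤ + 1)) -² V (i -ℤ + 2))) →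
    (e : ℤ → ℤ → Carrier) → IsCoxeterFrieze (+ (n ∸ 3)) e → (∀ i → e i i ≈ a i) →
    ∀ i → e (i -ℤ + 1) i ≈ crossRatio (p (i -ℤ + 3)) (p (i -ℤ + 2)) (p (i -ℤ + 1)) (p i)
proposition1p19 F _ (0 , ≡.refl) p periodic distinct _ _ _ _ _ _ _ _ _ _ _ i =
  ⊥-elim (distinct i (≈P-sym (p (i +ℤ + 1)) (p i) (periodic i)))
  where open FieldDefs F; open FieldProperties F
proposition1p19 F _ (1 , ≡.refl) p periodic _ _ _ _ _ _ _ _ _ _ frieze _ i =
  trans (frieze-width0 frieze i)
        (sym (crossRatio-coincident (p (i -ℤ + 3)) (p (i -ℤ + 2)) (p (i -ℤ + 1)) (p i) pᵢ≈pᵢ₋₃))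
  where
  open FieldDefs F
  open FieldProperties F
  pᵢ≈pᵢ₋₃ : p i ≈P p (i -ℤ + 3)
  pᵢ≈pᵢ₋₃ = ≡.subst (λ t → p t ≈P p (i -ℤ + 3)) (i-3+3≡i i) (periodic (i -ℤ + 3))
proposition1p19 F _ (N.suc (N.suc k) , ≡.refl) p _ _ V _ _ lift _ unimodular a recurrence e frieze diagonal i =
  begin
    e (i -ℤ + 1) i                             ≈⟨ frieze-secondRow width≥1 frieze i ⟩
    e (i -ℤ + 1) (i -ℤ + 1) * e i i - 1#       ≈⟨ +-congʳ (*-cong (diagonal _) (diagonal i)) ⟩
    a (i -ℤ + 1) * a i - 1#                    ≈⟨ det-three-apart recurrence unimodular i ⟨
    det (V i) (V (i -ℤ + 3))                   ≈⟨ crossRatio-consecutive {p = p} lift unimodular i ⟨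
    crossRatio (p (i -ℤ + 3)) (p (i -ℤ + 2)) (p (i -ℤ + 1)) (p i) ∎
  where
  open FieldDefs F
  open FieldProperties F
  open import Relation.Binary.Reasoning.Setoid setoid
  width≥1 : 1 N.≤ k N.+ N.suc (N.suc (k N.+ 0))
  width≥1 = ℕ.≤-trans (N.s≤s N.z≤n) (ℕ.m≤n+m _ k)
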